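{- Let $G=(V,E)$ and the algorithm be as described in the context, executed under the distributed fair daemon. Let $A\subseteq V$ be a maximal connected set of active processes in some configuration of an execution. If $|A|>2$, then after at most four more rounds the number of processes of $A$ that are still active has decreased by at least $2$.
   Context: Let $G=(V,E)$ be a finite simple undirected graph; each node is a process and $N(i)$ denotes the set of neighbours of $i$. Each process has an identifier from a totally ordered set; identifiers of any two distinct processes at distance at most $2$ are distinct, and comparisons such as $j>i$ between processes are comparisons of their identifiers. Each process $i$ holds variables $m_i\in\{\text{true},\text{false}\}$ and $p_i\in\{null\}\cup N(i)$; a configuration is an assignment of values to all these variables. Define the predicates $PRmarried(i)\equiv \exists j\in N(i): (p_i=j \text{ and } p_j=i)$ and $PRdead(i)\equiv (p_i=null)\text{ and }(\forall j\in N(i): PRmarried(j))$. A process $i$ is active in a configuration if neither $PRmarried(i)$ nor $PRdead(i)$ holds, and inactive otherwise; a maximal connected set of active processes is a set of active processes inducing a connected subgraph of $G$ and maximal with this property. The algorithm consists of the following four guarded rules for each process $i$ (a rule is enabled at $i$ if its guard holds; at most one rule is enabled at a process at any time): Update: if $m_i\neq PRmarried(i)$ then $m_i:=PRmarried(i)$. Marriage: if $m_i=PRmarried(i)$ and $p_i=null$ and there is $j\in N(i)$ with $p_j=i$, then $p_i:=j$ (for such a $j$). Seduction: if $m_i=PRmarried(i)$ and $p_i=null$ and $p_k\neq i$ for all $k\in N(i)$ and there is $j\in N(i)$ with $p_j=null$, $j>i$ and $m_j=\text{false}$, then $p_i:=\max\{j\in N(i): p_j=null,\ j>i,\ m_j=\text{false}\}$.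 Abandonment: if $m_i=PRmarried(i)$ and $p_i=j\neq null$ and $p_j\neq i$ and ($m_j=\text{true}$ or $j\le i$), then $p_i:=null$. A process is eligible if some rule is enabled at it. A step from a configuration $C$ consists of a nonempty subset of the processes eligible in $C$ each executing its enabled rule, all guards and assignments being evaluated in $C$; an execution is a maximal sequence of configurations, starting from an arbitrary configuration, each obtained from the previous one by a step. The execution of a rule by a process is a move. The distributed fair daemon additionally requires that every process which is continuously eligible eventually makes a move. A round is a smallest segment of an execution in which every process that was eligible at the beginning of the segment either makes a move or becomes ineligible during the segment; an execution is split into consecutive rounds. -}

module Defs where

open import Level using (0ℓ)
open import Data.Nat using (ℕ; zero; suc; _≤_; _<_; _+_)
open import Data.Fin using (Fin)
open import Data.Bool using (Bool; true; false)
open import Data.Maybe using (Maybe; just; nothing)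
open import Data.Product using (Σ; _×_; _,_)
open import Data.Sum using (_⊎_)
open import Relation.Nullary using (¬_)
open import Relation.Binary.PropositionalEquality using (_≡_; _≢_)
open import Relation.Binary.Bundles using (StrictTotalOrder)
open import Data.Fin.Subset using (Subset; _∈_; _⊆_; ∣_∣)

record System : Set₁ where
  field
    n        : ℕ
    E        : Fin n → Fin n → Bool
    E-sym    : ∀ i j → E i j ≡ E j i
    E-irrefl : ∀ i → E i i ≡ false
    O        : StrictTotalOrder 0ℓ 0ℓ 0ℓ
    ident    : Fin n → StrictTotalOrder.Carrier O
    ident-distinct : ∀ i j → i ≢ j →
      (E i j ≡ true ⊎ Σ (Fin n) (λ k → E i k ≡ true × E k j ≡ true)) →
      ¬ StrictTotalOrder._≈_ O (ident i) (ident j)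

-- A configuration: values of m_i and p_i (nothing = null).
record Config (n : ℕ) : Set where
  field
    m : Fin n → Bool
    p : Fin n → Maybe (Fin n)
open Config public

module _ (S : System) where
  open System S

  Adj : Fin n → Fin n → Set
  Adj i j = E i j ≡ true

  _<ᵢ_ : Fin n → Fin n → Set
  i <ᵢ j = StrictTotalOrder._<_ O (ident i) (ident j)

  _≤ᵢ_ : Fin n → Fin n → Set
  i ≤ᵢ j = i <ᵢ j ⊎ StrictTotalOrder._≈_ O (ident i) (ident j)

  ValidConfig : Config n → Set
  ValidConfig C = ∀ i j → p C i ≡ just j → Adj i j

  PRmarried : Config n → Fin n → Set
  PRmarried C i = Σ (Fin n) λ j → Adj i j × p C i ≡ just j × p C j ≡ just i

  PRdead : Config n → Fin n → Set
  PRdead C i = p C i ≡ nothing × (∀ j → Adj i j → PRmarried C j)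

  Active : Config n → Fin n → Set
  Active C i = ¬ PRmarried C i × ¬ PRdead C i

  MSync : Config n → Fin n → Set
  MSync C i = (m C i ≡ true × PRmarried C i) ⊎ (m C i ≡ false × ¬ PRmarried C i)

  UpdateEn : Config n → Fin n → Set
  UpdateEn C i = (m C i ≡ true × ¬ PRmarried C i) ⊎ (m C i ≡ false × PRmarried C i)

  MarriageEn : Config n → Fin n → Set
  MarriageEn C i = MSync C i × p C i ≡ nothing ×
    Σ (Fin n) (λ j → Adj i j × p C j ≡ just i)

  SedCand : Config n → Fin n → Fin n → Set
  SedCand C i j = Adj i j × p C j ≡ nothing × i <ᵢ j × m C j ≡ false

  SeductionEn : Config n → Fin n → Set
  SeductionEn C i = MSync C i × p C i ≡ nothing ×
    (∀ k → Adj i k → p C k ≢ just i) × Σ (Fin n) (SedCand C i)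

  AbandonmentEn : Config n → Fin n → Set
  AbandonmentEn C i = MSync C i × Σ (Fin n) λ j →
    p C i ≡ just j × p C j ≢ just i × (m C j ≡ true ⊎ j ≤ᵢ i)

  Eligible : Config n → Fin n → Set
  Eligible C i = UpdateEn C i ⊎ MarriageEn C i ⊎ SeductionEn C i ⊎ AbandonmentEn C i

  -- Move C i mv pv : process i, executing its enabled rule in C,
  -- sets (m_i , p_i) to (mv , pv).
  UpdateMove : Config n → Fin n → Bool → Maybe (Fin n) → Set
  UpdateMove C i mv pv = UpdateEn C i × pv ≡ p C i ×
    ((PRmarried C i × mv ≡ true) ⊎ (¬ PRmarried C i × mv ≡ false))

  MarriageMove : Config n → Fin n → Bool → Maybe (Fin n) → Set
  MarriageMove C i mv pv = MarriageEn C i × mv ≡ m C i ×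
    Σ (Fin n) (λ j → Adj i j × p C j ≡ just i × pv ≡ just j)

  SeductionMove : Config n → Fin n → Bool → Maybe (Fin n) → Set
  SeductionMove C i mv pv = SeductionEn C i × mv ≡ m C i ×
    Σ (Fin n) (λ j → SedCand C i j × (∀ k → SedCand C i k → k ≡ j ⊎ k <ᵢ j) × pv ≡ just j)

  AbandonmentMove : Config n → Fin n → Bool → Maybe (Fin n) → Set
  AbandonmentMove C i mv pv = AbandonmentEn C i × mv ≡ m C i × pv ≡ nothing

  Move : Config n → Fin n → Bool → Maybe (Fin n) → Set
  Move C i mv pv = UpdateMove C i mv pv ⊎ MarriageMove C i mv pv
                 ⊎ SeductionMove C i mv pv ⊎ AbandonmentMove C i mv pv

  Unchanged : Config n → Config n → Fin n → Set
  Unchanged C C' i = m C' i ≡ m C i × p C' i ≡ p C i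

  Step : Config n → (Fin n → Bool) → Config n → Set
  Step C σ C' = Σ (Fin n) (λ i → σ i ≡ true) ×
    (∀ i → σ i ≡ true → Move C i (m C' i) (p C' i)) ×
    (∀ i → σ i ≡ false → Unchanged C C' i)

  -- Terminal configuration (no eligible process): a finite maximal
  -- execution is represented by repeating its last configuration forever.
  Halt : Config n → (Fin n → Bool) → Config n → Set
  Halt C σ C' = (∀ i → ¬ Eligible C i) × (∀ i → σ i ≡ false) × (∀ i → Unchanged C C' i)

  record Execution : Set where
    field
      conf   : ℕ → Config n
      moves  : ℕ → Fin n → Bool
      valid₀ : ValidConfig (conf 0)
      step   : ∀ t → Step (conf t) (moves t) (conf (suc t)) ⊎ Halt (conf t) (moves t) (conf (suc t))
      fair   : ∀ i t → (∀ s → t ≤ s → Eligible (conf s) i) →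
               Σ ℕ λ s → t ≤ s × moves s i ≡ true
  open Execution public

  RoundDone : Execution → ℕ → ℕ → Set
  RoundDone e a b = ∀ i → Eligible (conf e a) i →
    Σ ℕ λ s → a ≤ s × s < b × (moves e s i ≡ true ⊎ ¬ Eligible (conf e (suc s)) i)

  RoundEnd : Execution → ℕ → ℕ → Set
  RoundEnd e a b = a < b × RoundDone e a b × (∀ b' → a < b' → b' < b → ¬ RoundDone e a b')

  data PathIn (A : Subset n) : Fin n → Fin n → Set where
    here  : ∀ {i} → PathIn A i i
    there : ∀ {i k j} → Adj i k → k ∈ A → PathIn A k j → PathIn A i j

  Connected : Subset n → Set
  Connected A = ∀ i j → i ∈ A → j ∈ A → PathIn A i j

  AllActive : Config n → Subset n → Set
  AllActive C A = ∀ i → i ∈ A → Active C i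

  MaxConnActive : Config n → Subset n → Set
  MaxConnActive C A = AllActive C A × Connected A ×
    (∀ B → A ⊆ B → AllActive C B → Connected B → B ⊆ A)

-- Outside neighbours of A are married at t (else they would extend A) and stay so, hence
-- never point into A. Suppose no member of A is married after the fourth round; then none is
-- married at any time in between. After one round every member has m = false and every outside
-- neighbour m = true. After two rounds a member's pointer is null or points to a larger member,
-- and such pointers never change again. A null member pointed to by another member would stay
-- enabled for Marriage during the whole fourth round without being able to marry; so after two
-- rounds no null member is pointed to, which forces every pointer to be null. But then during
-- the third round a neighbour of the largest member can only seduce it, producing exactly such a
-- pointer. So some member is married after four rounds, and so is its partner, also a member.
module Submission where

open import Defs
open import Level using (Level)
open import Data.Nat using (ℕ; zero; suc; _≤_; _<_; _+_; s≤s)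
open import Data.Nat.Properties using (≤-refl; ≤-trans; <⇒≤; <-irrefl; n≤1+n; m≤n⇒m<n∨m≡n; +-comm)
open import Data.Fin using (Fin)
open import Data.Fin.Properties using (_≟_; any?; all?)
open import Data.Fin.Subset using (Subset; _∈_; _∉_; _⊆_; _⊂_; _∪_; ⁅_⁆; ∣_∣; Nonempty)
open import Data.Fin.Subset.Properties
  using (_∈?_; ∣⊥∣≡0; ∣⁅x⁆∣≡1; p⊆q⇒∣p∣≤∣q∣; p⊂q⇒∣p∣<∣q∣; p⊆p∪q; x∈p∪q⁻; x∈p∪q⁺; x∈⁅x⁆;
         x∈⁅y⁆⇒x≡y; Empty-unique; nonempty?)
import Data.Bool as Bool
open import Data.Bool using (true; false)
open import Data.Bool.Properties using (T-≡)
open import Data.Maybe using (Maybe; just; nothing)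
import Data.Maybe.Properties as Maybe
open import Data.Vec using (tabulate)
open import Data.Vec.Properties using (lookup∘tabulate; []=⇒lookup; lookup⇒[]=)
open import Data.List using (List; []; _∷_; allFin)
open import Data.List.Relation.Unary.Any using (here; there)
import Data.List.Membership.Propositional as List
open import Data.List.Membership.Propositional.Properties using (∈-allFin)
open import Data.Product using (Σ; ∃; _×_; _,_; proj₁; proj₂)
open import Data.Sum using (_⊎_; inj₁; inj₂; [_,_]′)
open import Data.Empty using (⊥; ⊥-elim)
open import Function using (_∘_)
open import Function.Bundles using (_⇔_; mk⇔; Equivalence)
open import Relation.Nullary using (¬_; Dec; yes; no)
open import Relation.Nullary.Decidable using (isYes; toWitness; fromWitness; _×-dec_; _→-dec_; ¬?)
open import Relation.Unary using (Pred; Decidable)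
open import Relation.Binary.PropositionalEquality using (_≡_; _≢_; refl; sym; trans; subst)
open import Relation.Binary.Bundles using (StrictTotalOrder)
open import Relation.Binary.Definitions using (tri<; tri≈; tri>)

private
  variable
    ℓ : Level

interval-induction : (P : ℕ → Set ℓ) {a b : ℕ} →
  (∀ s → a ≤ s → s < b → P s → P (suc s)) → P a → ∀ s → a ≤ s → s ≤ b → P s
interval-induction P {a} step Pa s a≤s s≤b with m≤n⇒m<n∨m≡n a≤s
... | inj₂ refl = Pa
interval-induction P {a} step Pa (suc s) _ s<b | inj₁ (s≤s a≤s) =
  step s a≤s s<b (interval-induction P step Pa s a≤s (≤-trans (n≤1+n s) s<b))

module _ {a ℓ₁ ℓ₂} (O : StrictTotalOrder a ℓ₁ ℓ₂) {X : Set ℓ}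
         (key : X → StrictTotalOrder.Carrier O) where
  open StrictTotalOrder O using (compare; irrefl; asym; module Eq)
    renaming (_<_ to _⊏_; trans to ⊏-trans)

  private
    _≺_ : X → X → Set ℓ₂
    x ≺ y = key x ⊏ key y

  maximal-in-list : ∀ {p} {P : Pred X p} → Decidable P → (xs : List X) →
    (∀ {y} → y List.∈ xs → ¬ P y) ⊎ ∃ λ r → P r × ∀ {y} → y List.∈ xs → P y → ¬ r ≺ y
  maximal-in-list P? [] = inj₁ λ ()
  maximal-in-list P? (x ∷ xs) with P? x | maximal-in-list P? xs
  ... | no ¬Px | inj₁ none = inj₁ λ { (here refl) → ¬Px ; (there y∈) → none y∈ }
  ... | no ¬Px | inj₂ (r , Pr , max) =
    inj₂ (r , Pr , λ { (here refl) Px → ⊥-elim (¬Px Px) ; (there y∈) → max y∈ })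
  ... | yes Px | inj₁ none =
    inj₂ (x , Px , λ { (here refl) _ → irrefl Eq.refl ; (there y∈) Py → ⊥-elim (none y∈ Py) })
  ... | yes Px | inj₂ (r , Pr , max) with compare (key r) (key x)
  ...   | tri< r<x _ _ =
    inj₂ (x , Px , λ { (here refl) _ → irrefl Eq.refl
                     ; (there y∈) Py x<y → max y∈ Py (⊏-trans r<x x<y) })
  ...   | tri≈ _ r≈x _ = inj₂ (r , Pr , λ { (here refl) _ → irrefl r≈x ; (there y∈) → max y∈ })
  ...   | tri> _ _ x<r = inj₂ (r , Pr , λ { (here refl) _ → asym x<r ; (there y∈) → max y∈ })

  maximal : ∀ {p} {P : Pred X p} (xs : List X) → (∀ y → y List.∈ xs) → Decidable P →
    ∃ P → ∃ λ r → P r × ∀ y → P y → ¬ r ≺ y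
  maximal xs complete P? (x , Px) with maximal-in-list P? xs
  ... | inj₁ none = ⊥-elim (none (complete x) Px)
  ... | inj₂ (r , Pr , max) = r , Pr , λ y → max (complete y)

subsetOf : ∀ {n p} {P : Pred (Fin n) p} → Decidable P → Subset n
subsetOf P? = tabulate (isYes ∘ P?)

∈-subsetOf⇔ : ∀ {n p} {P : Pred (Fin n) p} (P? : Decidable P) i → (i ∈ subsetOf P?) ⇔ P i
∈-subsetOf⇔ P? i = mk⇔
  (λ i∈ → toWitness {a? = P? i}
            (Equivalence.from T-≡ (trans (sym (lookup∘tabulate _ i)) ([]=⇒lookup i∈))))
  (λ Pi → lookup⇒[]= i _ (trans (lookup∘tabulate _ i) (Equivalence.to T-≡ (fromWitness Pi))))

0<∣p∣⇒Nonempty : ∀ {n} (p : Subset n) → 0 < ∣ p ∣ → Nonempty p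
0<∣p∣⇒Nonempty {n} p 0<∣p∣ with nonempty? p
... | yes ne = ne
... | no empty with Empty-unique empty
...   | refl = ⊥-elim (<-irrefl refl (subst (0 <_) (∣⊥∣≡0 n) 0<∣p∣))

1<∣p∣⇒∃≢ : ∀ {n} (p : Subset n) → 1 < ∣ p ∣ → ∀ x → ∃ λ y → y ∈ p × y ≢ x
1<∣p∣⇒∃≢ p 1<∣p∣ x with any? (λ y → (y ∈? p) ×-dec ¬? (y ≟ x))
... | yes other = other
... | no none =
  ⊥-elim (<-irrefl refl (≤-trans 1<∣p∣ (subst (∣ p ∣ ≤_) (∣⁅x⁆∣≡1 x) (p⊆q⇒∣p∣≤∣q∣ p⊆⁅x⁆))))
  where
  p⊆⁅x⁆ : p ⊆ ⁅ x ⁆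
  p⊆⁅x⁆ {y} y∈p with y ≟ x
  ... | yes refl = x∈⁅x⁆ x
  ... | no y≢x = ⊥-elim (none (y , y∈p , y≢x))

∣p∣+2≤∣q∣ : ∀ {n} {p q : Subset n} {x y} → p ⊆ q → x ∈ q → y ∈ q → x ≢ y → x ∉ p → y ∉ p →
            ∣ p ∣ + 2 ≤ ∣ q ∣
∣p∣+2≤∣q∣ {p = p} {q} {x} {y} p⊆q x∈q y∈q x≢y x∉p y∉p =
  subst (_≤ ∣ q ∣) (+-comm 2 ∣ p ∣) (≤-trans (s≤s (p⊂q⇒∣p∣<∣q∣ p⊂p+x)) (p⊂q⇒∣p∣<∣q∣ p+x⊂q))
  where
  p+x⊆q : p ∪ ⁅ x ⁆ ⊆ q
  p+x⊆q z∈ with x∈p∪q⁻ p ⁅ x ⁆ z∈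
  ... | inj₁ z∈p = p⊆q z∈p
  ... | inj₂ z∈⁅x⁆ with x∈⁅y⁆⇒x≡y x z∈⁅x⁆
  ...   | refl = x∈q
  y∉p+x : y ∉ p ∪ ⁅ x ⁆
  y∉p+x y∈ with x∈p∪q⁻ p ⁅ x ⁆ y∈
  ... | inj₁ y∈p = y∉p y∈p
  ... | inj₂ y∈⁅x⁆ = x≢y (sym (x∈⁅y⁆⇒x≡y x y∈⁅x⁆))
  p⊂p+x : p ⊂ p ∪ ⁅ x ⁆
  p⊂p+x = p⊆p∪q ⁅ x ⁆ , x , x∈p∪q⁺ (inj₂ (x∈⁅x⁆ x)) , x∉p
  p+x⊂q : p ∪ ⁅ x ⁆ ⊂ q
  p+x⊂q = p+x⊆q , y , y∈q , y∉p+x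

just≢nothing : ∀ {a} {X : Set a} {x : X} → just x ≢ nothing
just≢nothing ()

true≢false : true ≢ false
true≢false ()

pattern update x      = inj₁ x
pattern marriage x    = inj₂ (inj₁ x)
pattern seduction x   = inj₂ (inj₂ (inj₁ x))
pattern abandonment x = inj₂ (inj₂ (inj₂ x))

module SystemFacts (S : System) where
  open System S
  module O = StrictTotalOrder O

  _≺_ _≼_ : Fin n → Fin n → Set
  _≺_ = _<ᵢ_ S
  _≼_ = _≤ᵢ_ S

  Adj-sym : ∀ {i j} → Adj S i j → Adj S j i
  Adj-sym {i} {j} adj = trans (E-sym j i) adj

  Adj⇒≢ : ∀ {i j} → Adj S i j → i ≢ j
  Adj⇒≢ {i} adj refl with trans (sym adj) (E-irrefl i)
  ... | ()

  Adj⇒≉ : ∀ {i j} → Adj S i j → ¬ ident i O.≈ ident j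
  Adj⇒≉ adj = ident-distinct _ _ (Adj⇒≢ adj) (inj₁ adj)

  ≺⇒⋡ : ∀ {i j} → i ≺ j → ¬ j ≼ i
  ≺⇒⋡ i<j (inj₁ j<i) = O.asym i<j j<i
  ≺⇒⋡ i<j (inj₂ j≈i) = O.irrefl (O.Eq.sym j≈i) i<j

  ⋡⇒≺ : ∀ {i j} → ¬ j ≼ i → i ≺ j
  ⋡⇒≺ {i} {j} j⋠i with O.compare (ident i) (ident j)
  ... | tri< i<j _ _ = i<j
  ... | tri≈ _ i≈j _ = ⊥-elim (j⋠i (inj₂ (O.Eq.sym i≈j)))
  ... | tri> _ _ j<i = ⊥-elim (j⋠i (inj₁ j<i))

  Adj∧≼⇒⋡ : ∀ {i j} → Adj S i j → i ≼ j → ¬ j ≼ i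
  Adj∧≼⇒⋡ adj (inj₁ i<j) = ≺⇒⋡ i<j
  Adj∧≼⇒⋡ adj (inj₂ i≈j) _ = Adj⇒≉ adj i≈j

  Adj∧⊀⇒≻ : ∀ {i j} → Adj S i j → ¬ i ≺ j → j ≺ i
  Adj∧⊀⇒≻ adj i⊀j = ⋡⇒≺ λ { (inj₁ i<j) → i⊀j i<j ; (inj₂ i≈j) → Adj⇒≉ adj i≈j }

  _≼?_ : ∀ i j → Dec (i ≼ j)
  i ≼? j with O.compare (ident i) (ident j)
  ... | tri< i<j _ _ = yes (inj₁ i<j)
  ... | tri≈ _ i≈j _ = yes (inj₂ i≈j)
  ... | tri> i≮j i≉j _ = no λ { (inj₁ i<j) → i≮j i<j ; (inj₂ i≈j) → i≉j i≈j }

  Adj? : ∀ i j → Dec (Adj S i j)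
  Adj? i j = E i j Bool.≟ true

  _≟ₘ_ : (x y : Maybe (Fin n)) → Dec (x ≡ y)
  _≟ₘ_ = Maybe.≡-dec _≟_

  PRmarried? : ∀ c i → Dec (PRmarried S c i)
  PRmarried? c i = any? λ j → Adj? i j ×-dec (p c i ≟ₘ just j) ×-dec (p c j ≟ₘ just i)

  Active? : ∀ c i → Dec (Active S c i)
  Active? c i = ¬? (PRmarried? c i) ×-dec
    ¬? ((p c i ≟ₘ nothing) ×-dec all? λ j → Adj? i j →-dec PRmarried? c j)

  PathIn-mono : ∀ {X Y} → X ⊆ Y → ∀ {x y} → PathIn S X x y → PathIn S Y x y
  PathIn-mono X⊆Y here = here
  PathIn-mono X⊆Y (there adj k∈X path) = there adj (X⊆Y k∈X) (PathIn-mono X⊆Y path)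

  PathIn-snoc : ∀ {X x y z} → PathIn S X x y → Adj S y z → z ∈ X → PathIn S X x z
  PathIn-snoc here adj z∈X = there adj z∈X here
  PathIn-snoc (there adj k∈X path) adj′ z∈X = there adj k∈X (PathIn-snoc path adj′ z∈X)

  PathIn-first : ∀ {X x y} → PathIn S X x y → x ≢ y → ∃ λ k → Adj S x k × k ∈ X
  PathIn-first here x≢x = ⊥-elim (x≢x refl)
  PathIn-first (there adj k∈X _) _ = _ , adj , k∈X

  -- Otherwise k, which is not dead since its neighbour i is unmarried, would extend A.
  MaxConnActive⇒neighbour-married : ∀ {c A i k} → MaxConnActive S c A →
    i ∈ A → Adj S i k → k ∉ A → PRmarried S c k
  MaxConnActive⇒neighbour-married {c} {A} {i} {k} (active , connected , maximal) i∈A adj k∉A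
    with PRmarried? c k
  ... | yes married = married
  ... | no unmarried = ⊥-elim (k∉A (maximal A+k (p⊆p∪q ⁅ k ⁆) active-A+k connected-A+k k∈A+k))
    where
    A+k : Subset n
    A+k = A ∪ ⁅ k ⁆
    A⊆A+k : A ⊆ A+k
    A⊆A+k x∈A = x∈p∪q⁺ (inj₁ x∈A)
    k∈A+k : k ∈ A+k
    k∈A+k = x∈p∪q⁺ (inj₂ (x∈⁅x⁆ k))
    A+k-cases : ∀ {x} → x ∈ A+k → x ∈ A ⊎ x ≡ k
    A+k-cases x∈ with x∈p∪q⁻ A ⁅ k ⁆ x∈
    ... | inj₁ x∈A = inj₁ x∈A
    ... | inj₂ x∈⁅k⁆ = inj₂ (x∈⁅y⁆⇒x≡y k x∈⁅k⁆)
    active-A+k : AllActive S c A+k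
    active-A+k x x∈ with A+k-cases x∈
    ... | inj₁ x∈A = active x x∈A
    ... | inj₂ refl = unmarried , λ dead → proj₁ (active i i∈A) (proj₂ dead i (Adj-sym adj))
    connected-A+k : Connected S A+k
    connected-A+k x y x∈ y∈ with A+k-cases x∈ | A+k-cases y∈
    ... | inj₁ x∈A | inj₁ y∈A = PathIn-mono A⊆A+k (connected x y x∈A y∈A)
    ... | inj₁ x∈A | inj₂ refl = PathIn-snoc (PathIn-mono A⊆A+k (connected x i x∈A i∈A)) adj k∈A+k
    ... | inj₂ refl | inj₁ y∈A =
      there (Adj-sym adj) (A⊆A+k i∈A) (PathIn-mono A⊆A+k (connected i y i∈A y∈A))
    ... | inj₂ refl | inj₂ refl = here

module ExecutionFacts (S : System) (e : Execution S) where
  open System S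
  open SystemFacts S

  C : ℕ → Config n
  C = conf e

  data Transition (s : ℕ) (i : Fin n) : Set where
    idle : Unchanged S (C s) (C (suc s)) i → Transition s i
    acts : Move S (C s) i (m (C (suc s)) i) (p (C (suc s)) i) → Transition s i

  transition : ∀ s i → Transition s i
  transition s i with step e s
  ... | inj₂ (_ , _ , unchanged) = idle (unchanged i)
  ... | inj₁ (_ , move , unchanged) with moves e s i in σi
  ...   | true  = acts (move i σi)
  ...   | false = idle (unchanged i σi)

  move-of : ∀ {s i} → moves e s i ≡ true → Move S (C s) i (m (C (suc s)) i) (p (C (suc s)) i)
  move-of {s} {i} σi with step e s
  ... | inj₁ (_ , move , _) = move i σi
  ... | inj₂ (_ , halted , _) = ⊥-elim (true≢false (trans (sym σi) (halted i)))

  MSync⇒¬UpdateEn : ∀ {c i} → MSync S c i → ¬ UpdateEn S c i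
  MSync⇒¬UpdateEn (inj₁ (_ , married)) (inj₁ (_ , unmarried)) = unmarried married
  MSync⇒¬UpdateEn (inj₁ (m≡true , _)) (inj₂ (m≡false , _)) = true≢false (trans (sym m≡true) m≡false)
  MSync⇒¬UpdateEn (inj₂ (m≡false , _)) (inj₁ (m≡true , _)) = true≢false (trans (sym m≡true) m≡false)
  MSync⇒¬UpdateEn (inj₂ (_ , unmarried)) (inj₂ (_ , married)) = unmarried married

  MSync⊎UpdateEn : ∀ c i → MSync S c i ⊎ UpdateEn S c i
  MSync⊎UpdateEn c i with m c i | PRmarried? c i
  ... | true  | yes married  = inj₁ (inj₁ (refl , married))
  ... | true  | no unmarried = inj₂ (inj₁ (refl , unmarried))
  ... | false | yes married  = inj₂ (inj₂ (refl , married))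
  ... | false | no unmarried = inj₁ (inj₂ (refl , unmarried))

  MSync-transport : ∀ {c c′ i} → m c′ i ≡ m c i →
    (PRmarried S c i → PRmarried S c′ i) → (¬ PRmarried S c i → ¬ PRmarried S c′ i) →
    MSync S c i → MSync S c′ i
  MSync-transport m≡ to _ (inj₁ (m≡true , married)) = inj₁ (trans m≡ m≡true , to married)
  MSync-transport m≡ _ to (inj₂ (m≡false , unmarried)) = inj₂ (trans m≡ m≡false , to unmarried)

  valid : ∀ s → ValidConfig S (C s)
  valid zero = valid₀ e
  valid (suc s) i j pi≡j with transition s i
  ... | idle (_ , p≡) = valid s i j (trans (sym p≡) pi≡j)
  ... | acts (update (_ , p≡ , _)) = valid s i j (trans (sym p≡) pi≡j)
  ... | acts (marriage (_ , _ , k , adj , _ , pi≡k)) =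
    subst (Adj S i) (Maybe.just-injective (trans (sym pi≡k) pi≡j)) adj
  ... | acts (seduction (_ , _ , k , (adj , _) , _ , pi≡k)) =
    subst (Adj S i) (Maybe.just-injective (trans (sym pi≡k) pi≡j)) adj
  ... | acts (abandonment (_ , _ , pi≡nothing)) = ⊥-elim (just≢nothing (trans (sym pi≡j) pi≡nothing))

  pointer-step : ∀ {s i j} → p (C s) i ≡ just j →
    p (C (suc s)) i ≡ just j ⊎ (p (C (suc s)) i ≡ nothing × AbandonmentEn S (C s) i)
  pointer-step {s} {i} pi≡j with transition s i
  ... | idle (_ , p≡) = inj₁ (trans p≡ pi≡j)
  ... | acts (update (_ , p≡ , _)) = inj₁ (trans p≡ pi≡j)
  ... | acts (marriage ((_ , pi≡nothing , _) , _)) = ⊥-elim (just≢nothing (trans (sym pi≡j) pi≡nothing))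
  ... | acts (seduction ((_ , pi≡nothing , _) , _)) = ⊥-elim (just≢nothing (trans (sym pi≡j) pi≡nothing))
  ... | acts (abandonment (enabled , _ , pi≡nothing)) = inj₂ (pi≡nothing , enabled)

  data NullPointerStep (s : ℕ) (i : Fin n) : Set where
    stays-null : p (C (suc s)) i ≡ nothing → NullPointerStep s i
    marries    : ∀ k → Adj S i k → p (C s) k ≡ just i → p (C (suc s)) i ≡ just k → NullPointerStep s i
    seduces    : SeductionEn S (C s) i → ∀ j → SedCand S (C s) i j →
                 (∀ k → SedCand S (C s) i k → k ≡ j ⊎ k ≺ j) →
                 p (C (suc s)) i ≡ just j → NullPointerStep s i

  null-pointer-step : ∀ {s i} → p (C s) i ≡ nothing → NullPointerStep s i
  null-pointer-step {s} {i} pi≡nothing with transition s i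
  ... | idle (_ , p≡) = stays-null (trans p≡ pi≡nothing)
  ... | acts (update (_ , p≡ , _)) = stays-null (trans p≡ pi≡nothing)
  ... | acts (marriage (_ , _ , k , adj , pk≡i , pi≡k)) = marries k adj pk≡i pi≡k
  ... | acts (seduction (enabled , _ , j , candidate , largest , pi≡j)) =
    seduces enabled j candidate largest pi≡j
  ... | acts (abandonment (_ , _ , p≡nothing)) = stays-null p≡nothing

  abandonment-clears : ∀ {c i mv pv} → AbandonmentEn S c i → Move S c i mv pv → pv ≡ nothing
  abandonment-clears {c} {i} (sync , _) (update (enabled , _)) =
    ⊥-elim (MSync⇒¬UpdateEn {c} {i} sync enabled)
  abandonment-clears (_ , _ , pi≡j , _) (marriage ((_ , pi≡nothing , _) , _)) =
    ⊥-elim (just≢nothing (trans (sym pi≡j) pi≡nothing))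
  abandonment-clears (_ , _ , pi≡j , _) (seduction ((_ , pi≡nothing , _) , _)) =
    ⊥-elim (just≢nothing (trans (sym pi≡j) pi≡nothing))
  abandonment-clears _ (abandonment (_ , _ , pv≡nothing)) = pv≡nothing

  Partners : ℕ → Fin n → Fin n → Set
  Partners s i j = p (C s) i ≡ just j × p (C s) j ≡ just i

  Partners⇒¬AbandonmentEn : ∀ {s i j} → Partners s i j → ¬ AbandonmentEn S (C s) i
  Partners⇒¬AbandonmentEn {s} {i} (pi≡j , pj≡i) (_ , k , pi≡k , pk≢i , _)
    with Maybe.just-injective (trans (sym pi≡j) pi≡k)
  ... | refl = pk≢i pj≡i

  Partners-step : ∀ {s i j} → Partners s i j → Partners (suc s) i j
  Partners-step (pi≡j , pj≡i) with pointer-step pi≡j | pointer-step pj≡i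
  ... | inj₁ pi≡j′ | inj₁ pj≡i′ = pi≡j′ , pj≡i′
  ... | inj₂ (_ , abandons) | _ = ⊥-elim (Partners⇒¬AbandonmentEn (pi≡j , pj≡i) abandons)
  ... | inj₁ _ | inj₂ (_ , abandons) = ⊥-elim (Partners⇒¬AbandonmentEn (pj≡i , pi≡j) abandons)

  Partners-persist : ∀ {a b i j} → a ≤ b → Partners a i j → Partners b i j
  Partners-persist {b = b} {i} {j} a≤b partners =
    interval-induction (λ s → Partners s i j) (λ _ _ _ → Partners-step) partners b a≤b ≤-refl

  married-persists : ∀ {a b i} → a ≤ b → PRmarried S (C a) i → PRmarried S (C b) i
  married-persists a≤b (j , adj , partners) = j , adj , Partners-persist a≤b partners

  -- Within a round, a process that is eligible whenever B holds must move or become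
  -- ineligible, so it ends the round in G provided moving out of B leads to G.
  round-establishes : ∀ {a b} x (G B : ℕ → Set) → RoundDone S e a b → a ≤ b →
    (∀ s → a ≤ s → s < b → G s → G (suc s)) →
    (∀ s → a ≤ s → s ≤ b → G s ⊎ B s) →
    (∀ s → a ≤ s → s ≤ b → B s → Eligible S (C s) x) →
    (∀ s → a ≤ s → s < b → B s → moves e s x ≡ true → G (suc s)) →
    G b
  round-establishes {a} {b} x G B done a≤b keep G⊎B B⇒eligible B⇒move with G⊎B a ≤-refl a≤b
  ... | inj₁ Ga = interval-induction G keep Ga b a≤b ≤-refl
  ... | inj₂ Ba with done x (B⇒eligible a ≤-refl a≤b Ba)
  ...   | s , a≤s , s<b , reaction =
    interval-induction G (λ s′ s<s′ → keep s′ (≤-trans a≤s (≤-trans (n≤1+n s) s<s′)))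
      (after reaction) b s<b ≤-refl
    where
    a≤1+s : a ≤ suc s
    a≤1+s = ≤-trans a≤s (n≤1+n s)
    after : moves e s x ≡ true ⊎ ¬ Eligible S (C (suc s)) x → G (suc s)
    after reaction with G⊎B s a≤s (≤-trans (n≤1+n s) s<b)
    ... | inj₁ Gs = keep s a≤s s<b Gs
    ... | inj₂ Bs with reaction | G⊎B (suc s) a≤1+s s<b
    ...   | inj₁ moved | _ = B⇒move s a≤s s<b Bs moved
    ...   | inj₂ _ | inj₁ G1+s = G1+s
    ...   | inj₂ ineligible | inj₂ B1+s = ⊥-elim (ineligible (B⇒eligible (suc s) a≤1+s s<b B1+s))

  MSync-step : ∀ {s i} → (¬ PRmarried S (C s) i → ¬ PRmarried S (C (suc s)) i) →
    MSync S (C s) i → MSync S (C (suc s)) i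
  MSync-step {s} {i} frozen sync =
    MSync-transport {C s} {C (suc s)} m-kept (married-persists (n≤1+n s)) frozen sync
    where
    m-kept : m (C (suc s)) i ≡ m (C s) i
    m-kept with transition s i
    ... | idle (m≡ , _) = m≡
    ... | acts (update (enabled , _)) = ⊥-elim (MSync⇒¬UpdateEn {C s} {i} sync enabled)
    ... | acts (marriage (_ , m≡ , _)) = m≡
    ... | acts (seduction (_ , m≡ , _)) = m≡
    ... | acts (abandonment (_ , m≡ , _)) = m≡

  update-syncs : ∀ {s i} → (¬ PRmarried S (C s) i → ¬ PRmarried S (C (suc s)) i) →
    UpdateEn S (C s) i → moves e s i ≡ true → MSync S (C (suc s)) i
  update-syncs {s} {i} frozen enabled moved with move-of moved
  ... | update (_ , _ , inj₁ (married , m≡true)) = inj₁ (m≡true , married-persists (n≤1+n s) married)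
  ... | update (_ , _ , inj₂ (unmarried , m≡false)) = inj₂ (m≡false , frozen unmarried)
  ... | marriage ((sync , _) , _) = ⊥-elim (MSync⇒¬UpdateEn {C s} {i} sync enabled)
  ... | seduction ((sync , _) , _) = ⊥-elim (MSync⇒¬UpdateEn {C s} {i} sync enabled)
  ... | abandonment ((sync , _) , _) = ⊥-elim (MSync⇒¬UpdateEn {C s} {i} sync enabled)

  MSync-after-round : ∀ {a b c} i → RoundDone S e a b → a ≤ b → b ≤ c →
    (∀ s → a ≤ s → s < c → ¬ PRmarried S (C s) i → ¬ PRmarried S (C (suc s)) i) →
    ∀ s → b ≤ s → s ≤ c → MSync S (C s) i
  MSync-after-round {a} {b} {c} i done a≤b b≤c frozen =
    interval-induction (λ s → MSync S (C s) i)
      (λ s b≤s s<c → MSync-step (frozen s (≤-trans a≤b b≤s) s<c)) synced-at-b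
    where
    synced-at-b : MSync S (C b) i
    synced-at-b = round-establishes i (λ s → MSync S (C s) i) (λ s → UpdateEn S (C s) i) done a≤b
      (λ s a≤s s<b → MSync-step (frozen s a≤s (≤-trans s<b b≤c)))
      (λ s _ _ → MSync⊎UpdateEn (C s) i)
      (λ _ _ _ enabled → update enabled)
      (λ s a≤s s<b → update-syncs (frozen s a≤s (≤-trans s<b b≤c)))

module FourRounds (S : System) (e : Execution S) (t : ℕ) (A : Subset (System.n S))
  (maxA : MaxConnActive S (conf e t) A) (r₁ r₂ r₃ r₄ : ℕ)
  (round₁ : RoundEnd S e t r₁) (round₂ : RoundEnd S e r₁ r₂)
  (round₃ : RoundEnd S e r₂ r₃) (round₄ : RoundEnd S e r₃ r₄) where
  open System S
  open SystemFacts S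
  open ExecutionFacts S e

  t≤r₁ : t ≤ r₁
  t≤r₁ = <⇒≤ (proj₁ round₁)
  r₁≤r₂ : r₁ ≤ r₂
  r₁≤r₂ = <⇒≤ (proj₁ round₂)
  r₂≤r₃ : r₂ ≤ r₃
  r₂≤r₃ = <⇒≤ (proj₁ round₃)
  r₃≤r₄ : r₃ ≤ r₄
  r₃≤r₄ = <⇒≤ (proj₁ round₄)
  r₂≤r₄ : r₂ ≤ r₄
  r₂≤r₄ = ≤-trans r₂≤r₃ r₃≤r₄
  r₁≤r₄ : r₁ ≤ r₄
  r₁≤r₄ = ≤-trans r₁≤r₂ r₂≤r₄
  t≤r₂ : t ≤ r₂
  t≤r₂ = ≤-trans t≤r₁ r₁≤r₂

  outsider-married : ∀ {i k} → i ∈ A → Adj S i k → k ∉ A → ∀ {s} → t ≤ s → PRmarried S (C s) k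
  outsider-married i∈A adj k∉A t≤s =
    married-persists t≤s (MaxConnActive⇒neighbour-married {C t} maxA i∈A adj k∉A)

  -- The partner of an outsider k is fixed from t on, and it cannot be i, unmarried at t.
  outsider-ignores-A : ∀ {i k s} → i ∈ A → k ∉ A → t ≤ s → p (C s) k ≢ just i
  outsider-ignores-A {i} {k} {s} i∈A k∉A t≤s pk≡i
    with MaxConnActive⇒neighbour-married {C t} maxA i∈A (Adj-sym (valid s k i pk≡i)) k∉A
  ... | q , adj , partners with Partners-persist t≤s partners
  ...   | pk≡q , _ with Maybe.just-injective (trans (sym pk≡q) pk≡i)
  ...     | refl = proj₁ (proj₁ maxA i i∈A) (k , Adj-sym adj , proj₂ partners , proj₁ partners)

  module NoMemberMarried (unmarried-at-r₄ : ∀ {i} → i ∈ A → ¬ PRmarried S (C r₄) i) where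

    unmarried : ∀ {s i} → s ≤ r₄ → i ∈ A → ¬ PRmarried S (C s) i
    unmarried s≤r₄ i∈A married = unmarried-at-r₄ i∈A (married-persists s≤r₄ married)

    synced : ∀ {s i} → i ∈ A → r₁ ≤ s → s ≤ r₄ → MSync S (C s) i
    synced {s} {i} i∈A = MSync-after-round i (proj₁ (proj₂ round₁)) t≤r₁ r₁≤r₄
      (λ _ _ s<r₄ _ → unmarried s<r₄ i∈A) s

    member-m≡false : ∀ {s i} → i ∈ A → r₁ ≤ s → s ≤ r₄ → m (C s) i ≡ false
    member-m≡false i∈A r₁≤s s≤r₄ with synced i∈A r₁≤s s≤r₄
    ... | inj₁ (_ , married) = ⊥-elim (unmarried s≤r₄ i∈A married)
    ... | inj₂ (m≡false , _) = m≡false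

    outsider-m≡true : ∀ {s i k} → i ∈ A → Adj S i k → k ∉ A → r₁ ≤ s → s ≤ r₄ → m (C s) k ≡ true
    outsider-m≡true {s} {i} {k} i∈A adj k∉A r₁≤s s≤r₄
      with MSync-after-round k (proj₁ (proj₂ round₁)) t≤r₁ r₁≤r₄
             (λ _ t≤s′ _ unmarried′ → ⊥-elim (unmarried′ (outsider-married i∈A adj k∉A t≤s′)))
             s r₁≤s s≤r₄
    ... | inj₁ (m≡true , _) = m≡true
    ... | inj₂ (_ , unmarried′) = ⊥-elim (unmarried′ (outsider-married i∈A adj k∉A (≤-trans t≤r₁ r₁≤s)))

    outsider-not-candidate : ∀ {s i k} → i ∈ A → k ∉ A → r₁ ≤ s → s ≤ r₄ → ¬ SedCand S (C s) i k
    outsider-not-candidate i∈A k∉A r₁≤s s≤r₄ (adj , _ , _ , m≡false) =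
      true≢false (trans (sym (outsider-m≡true i∈A adj k∉A r₁≤s s≤r₄)) m≡false)

    abandons-only-lower : ∀ {s k j} → j ∈ A → r₁ ≤ s → s ≤ r₄ →
      AbandonmentEn S (C s) k → p (C s) k ≡ just j → j ≼ k
    abandons-only-lower j∈A r₁≤s s≤r₄ (_ , j′ , pk≡j′ , _ , condition) pk≡j
      with Maybe.just-injective (trans (sym pk≡j) pk≡j′)
    ... | refl with condition
    ...   | inj₁ m≡true = ⊥-elim (true≢false (trans (sym m≡true) (member-m≡false j∈A r₁≤s s≤r₄)))
    ...   | inj₂ j≼k = j≼k

    PointsUp : ℕ → Fin n → Set
    PointsUp s i = p (C s) i ≡ nothing ⊎ ∃ λ j → p (C s) i ≡ just j × j ∈ A × i ≺ j

    PointsUp-step-from-null : ∀ {s i} → i ∈ A → r₁ ≤ s → s < r₄ →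
      p (C s) i ≡ nothing → PointsUp (suc s) i
    PointsUp-step-from-null {s} {i} i∈A r₁≤s s<r₄ pi≡nothing with null-pointer-step pi≡nothing
    ... | stays-null pi≡nothing′ = inj₁ pi≡nothing′
    ... | seduces _ j candidate _ pi≡j with j ∈? A
    ...   | yes j∈A = inj₂ (j , pi≡j , j∈A , proj₁ (proj₂ (proj₂ candidate)))
    ...   | no j∉A = ⊥-elim (outsider-not-candidate i∈A j∉A r₁≤s (<⇒≤ s<r₄) candidate)
    -- i stays unmarried after answering k only if k abandons i in the same step, which k
    -- does only when i ≼ k.
    PointsUp-step-from-null {s} {i} i∈A r₁≤s s<r₄ pi≡nothing | marries k adj pk≡i pi≡k
      with pointer-step pk≡i
    ... | inj₁ pk≡i′ = ⊥-elim (unmarried s<r₄ i∈A (k , adj , pi≡k , pk≡i′))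
    ... | inj₂ (_ , abandons) with k ∈? A
    ...   | no k∉A = ⊥-elim (outsider-ignores-A i∈A k∉A (≤-trans t≤r₁ r₁≤s) pk≡i)
    ...   | yes k∈A = inj₂ (k , pi≡k , k∈A ,
                        ⋡⇒≺ (Adj∧≼⇒⋡ adj (abandons-only-lower i∈A r₁≤s (<⇒≤ s<r₄) abandons pk≡i)))

    PointsUp-step : ∀ {s i} → i ∈ A → r₁ ≤ s → s < r₄ → PointsUp s i → PointsUp (suc s) i
    PointsUp-step i∈A r₁≤s s<r₄ (inj₁ pi≡nothing) = PointsUp-step-from-null i∈A r₁≤s s<r₄ pi≡nothing
    PointsUp-step i∈A r₁≤s s<r₄ (inj₂ (j , pi≡j , j∈A , i≺j)) with pointer-step pi≡j
    ... | inj₁ pi≡j′ = inj₂ (j , pi≡j′ , j∈A , i≺j)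
    ... | inj₂ (_ , abandons) = ⊥-elim (≺⇒⋡ i≺j (abandons-only-lower j∈A r₁≤s (<⇒≤ s<r₄) abandons pi≡j))

    PointsUp⊎AbandonmentEn : ∀ {s i} → i ∈ A → r₁ ≤ s → s ≤ r₄ →
      PointsUp s i ⊎ AbandonmentEn S (C s) i
    PointsUp⊎AbandonmentEn {s} {i} i∈A r₁≤s s≤r₄ = by-pointer (p (C s) i) refl
      where
      by-pointer : ∀ q → p (C s) i ≡ q → PointsUp s i ⊎ AbandonmentEn S (C s) i
      by-pointer nothing pi≡nothing = inj₁ (inj₁ pi≡nothing)
      by-pointer (just j) pi≡j with j ∈? A
      ... | no j∉A = inj₂ (synced i∈A r₁≤s s≤r₄ , j , pi≡j ,
              outsider-ignores-A i∈A j∉A (≤-trans t≤r₁ r₁≤s) ,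
              inj₁ (outsider-m≡true i∈A (valid s i j pi≡j) j∉A r₁≤s s≤r₄))
      ... | yes j∈A with j ≼? i
      ...   | yes j≼i = inj₂ (synced i∈A r₁≤s s≤r₄ , j , pi≡j ,
                (λ pj≡i → unmarried s≤r₄ i∈A (j , valid s i j pi≡j , pi≡j , pj≡i)) , inj₂ j≼i)
      ...   | no j⋠i = inj₁ (inj₂ (j , pi≡j , j∈A , ⋡⇒≺ j⋠i))

    points-up : ∀ {s i} → i ∈ A → r₂ ≤ s → s ≤ r₄ → PointsUp s i
    points-up {s} {i} i∈A =
      interval-induction (λ s → PointsUp s i)
        (λ s r₂≤s → PointsUp-step i∈A (≤-trans r₁≤r₂ r₂≤s)) points-up-at-r₂ s
      where
      points-up-at-r₂ : PointsUp r₂ i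
      points-up-at-r₂ =
        round-establishes i (λ s → PointsUp s i) (λ s → AbandonmentEn S (C s) i)
          (proj₁ (proj₂ round₂)) r₁≤r₂
          (λ s r₁≤s s<r₂ → PointsUp-step i∈A r₁≤s (≤-trans s<r₂ r₂≤r₄))
          (λ s r₁≤s s≤r₂ → PointsUp⊎AbandonmentEn i∈A r₁≤s (≤-trans s≤r₂ r₂≤r₄))
          (λ _ _ _ abandons → abandonment abandons)
          (λ _ _ _ abandons moved → inj₁ (abandonment-clears abandons (move-of moved)))

    points-up-to : ∀ {s i j} → i ∈ A → r₂ ≤ s → s ≤ r₄ → p (C s) i ≡ just j → j ∈ A × i ≺ j
    points-up-to i∈A r₂≤s s≤r₄ pi≡j with points-up i∈A r₂≤s s≤r₄
    ... | inj₁ pi≡nothing = ⊥-elim (just≢nothing (trans (sym pi≡j) pi≡nothing))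
    ... | inj₂ (j′ , pi≡j′ , j′∈A , i≺j′) with Maybe.just-injective (trans (sym pi≡j) pi≡j′)
    ...   | refl = j′∈A , i≺j′

    -- Marrying k would make i point up to k while k points up to i.
    no-marriage : ∀ {s i k} → i ∈ A → r₂ ≤ s → s < r₄ →
      p (C s) k ≡ just i → p (C (suc s)) i ≢ just k
    no-marriage {s} {i} {k} i∈A r₂≤s s<r₄ pk≡i pi≡k with k ∈? A
    ... | no k∉A = outsider-ignores-A i∈A k∉A (≤-trans t≤r₂ r₂≤s) pk≡i
    ... | yes k∈A = O.asym (proj₂ (points-up-to i∈A (≤-trans r₂≤s (n≤1+n s)) s<r₄ pi≡k))
                          (proj₂ (points-up-to k∈A r₂≤s (<⇒≤ s<r₄) pk≡i))

    pointer-stays : ∀ {s i k} → k ∈ A → r₂ ≤ s → s < r₄ →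
      p (C s) k ≡ just i → p (C (suc s)) k ≡ just i
    pointer-stays k∈A r₂≤s s<r₄ pk≡i with pointer-step pk≡i
    ... | inj₁ pk≡i′ = pk≡i′
    ... | inj₂ (_ , abandons) with points-up-to k∈A r₂≤s (<⇒≤ s<r₄) pk≡i
    ...   | i∈A , k≺i =
      ⊥-elim (≺⇒⋡ k≺i (abandons-only-lower i∈A (≤-trans r₁≤r₂ r₂≤s) (<⇒≤ s<r₄) abandons pk≡i))

    -- Otherwise i would stay enabled for Marriage through the fourth round without
    -- being able to execute it.
    no-pointer-to-null : ∀ {s i k} → i ∈ A → k ∈ A → r₂ ≤ s → s ≤ r₃ →
      p (C s) i ≡ nothing → p (C s) k ≢ just i
    no-pointer-to-null {s} {i} {k} i∈A k∈A r₂≤s s≤r₃ pi≡nothing pk≡i =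
      round-establishes i (λ _ → ⊥) (λ s′ → MarriageEn S (C s′) i) (proj₁ (proj₂ round₄)) r₃≤r₄
        (λ _ _ _ ())
        (λ s′ r₃≤s′ s′≤r₄ → inj₂ (marriage-enabled (≤-trans s≤r₃ r₃≤s′) s′≤r₄))
        (λ _ _ _ enabled → marriage enabled)
        (λ s′ r₃≤s′ s′<r₄ _ moved → cannot-move (≤-trans s≤r₃ r₃≤s′) s′<r₄ (move-of moved))
      where
      r₂≤ : ∀ {s′} → s ≤ s′ → r₂ ≤ s′
      r₂≤ s≤s′ = ≤-trans r₂≤s s≤s′
      Courted : ℕ → Set
      Courted s′ = p (C s′) i ≡ nothing × p (C s′) k ≡ just i
      courted-step : ∀ s′ → s ≤ s′ → s′ < r₄ → Courted s′ → Courted (suc s′)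
      courted-step s′ s≤s′ s′<r₄ (pi≡nothing′ , pk≡i′) with null-pointer-step pi≡nothing′
      ... | stays-null pi≡nothing″ = pi≡nothing″ , pointer-stays k∈A (r₂≤ s≤s′) s′<r₄ pk≡i′
      ... | marries k′ _ pk′≡i pi≡k′ = ⊥-elim (no-marriage i∈A (r₂≤ s≤s′) s′<r₄ pk′≡i pi≡k′)
      ... | seduces (_ , _ , unpointed , _) _ _ _ _ =
        ⊥-elim (unpointed k (Adj-sym (valid s′ k i pk≡i′)) pk≡i′)
      courted : ∀ {s′} → s ≤ s′ → s′ ≤ r₄ → Courted s′
      courted {s′} = interval-induction Courted courted-step (pi≡nothing , pk≡i) s′
      marriage-enabled : ∀ {s′} → s ≤ s′ → s′ ≤ r₄ → MarriageEn S (C s′) i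
      marriage-enabled {s′} s≤s′ s′≤r₄ with courted s≤s′ s′≤r₄
      ... | pi≡nothing′ , pk≡i′ =
        synced i∈A (≤-trans r₁≤r₂ (r₂≤ s≤s′)) s′≤r₄ , pi≡nothing′ ,
        k , Adj-sym (valid s′ k i pk≡i′) , pk≡i′
      cannot-move : ∀ {s′} → s ≤ s′ → s′ < r₄ →
        Move S (C s′) i (m (C (suc s′)) i) (p (C (suc s′)) i) → ⊥
      cannot-move {s′} s≤s′ s′<r₄ (update (enabled , _)) =
        MSync⇒¬UpdateEn {C s′} {i} (synced i∈A (≤-trans r₁≤r₂ (r₂≤ s≤s′)) (<⇒≤ s′<r₄)) enabled
      cannot-move s≤s′ s′<r₄ (marriage (_ , _ , k′ , _ , pk′≡i , pi≡k′)) =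
        no-marriage i∈A (r₂≤ s≤s′) s′<r₄ pk′≡i pi≡k′
      cannot-move {s′} s≤s′ s′<r₄ (seduction ((_ , _ , unpointed , _) , _)) with courted s≤s′ (<⇒≤ s′<r₄)
      ... | _ , pk≡i′ = unpointed k (Adj-sym (valid s′ k i pk≡i′)) pk≡i′
      cannot-move {s′} s≤s′ s′<r₄ (abandonment ((_ , _ , pi≡j , _) , _)) =
        just≢nothing (trans (sym pi≡j) (proj₁ (courted s≤s′ (<⇒≤ s′<r₄))))

    -- A largest member with a non-null pointer would point up to a member that is
    -- larger still, hence null, which no-pointer-to-null forbids.
    all-null-at-r₂ : ∀ {i} → i ∈ A → p (C r₂) i ≡ nothing
    all-null-at-r₂ {i} i∈A with p (C r₂) i ≟ₘ nothing
    ... | yes pi≡nothing = pi≡nothing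
    ... | no pi≢nothing
      with maximal O ident (allFin n) ∈-allFin (λ j → (j ∈? A) ×-dec ¬? (p (C r₂) j ≟ₘ nothing))
             (i , i∈A , pi≢nothing)
    ...   | r , (r∈A , pr≢nothing) , largest = ⊥-elim (by-pointer (p (C r₂) r) refl)
      where
      by-pointer : ∀ q → p (C r₂) r ≡ q → ⊥
      by-pointer nothing pr≡nothing = pr≢nothing pr≡nothing
      by-pointer (just j) pr≡j with points-up-to r∈A ≤-refl r₂≤r₄ pr≡j
      ... | j∈A , r≺j with p (C r₂) j ≟ₘ nothing
      ...   | yes pj≡nothing = no-pointer-to-null j∈A r∈A ≤-refl r₂≤r₃ pj≡nothing pr≡j
      ...   | no pj≢nothing = largest j (j∈A , pj≢nothing) r≺j

    -- The largest member M stays null, so in the third round its smaller neighbour u is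
    -- enabled for Seduction and can only seduce M; then u points to M while M is null.
    maximum-not-seduced : ∀ {M u} → M ∈ A → (∀ j → j ∈ A → ¬ M ≺ j) → u ∈ A → Adj S M u → ⊥
    maximum-not-seduced {M} {u} M∈A M-largest u∈A adj =
      no-pointer-to-null M∈A u∈A r₂≤r₃ ≤-refl (M-null r₂≤r₃ r₃≤r₄) u→M-at-r₃
      where
      M-null : ∀ {s} → r₂ ≤ s → s ≤ r₄ → p (C s) M ≡ nothing
      M-null {s} r₂≤s s≤r₄ with points-up M∈A r₂≤s s≤r₄
      ... | inj₁ pM≡nothing = pM≡nothing
      ... | inj₂ (j , _ , j∈A , M≺j) = ⊥-elim (M-largest j j∈A M≺j)
      M-candidate : ∀ {s} → r₂ ≤ s → s ≤ r₄ → SedCand S (C s) u M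
      M-candidate r₂≤s s≤r₄ =
        Adj-sym adj , M-null r₂≤s s≤r₄ , Adj∧⊀⇒≻ adj (M-largest u u∈A) ,
        member-m≡false M∈A (≤-trans r₁≤r₂ r₂≤s) s≤r₄
      seduces-M : ∀ {s j} → r₂ ≤ s → s ≤ r₄ → SedCand S (C s) u j →
        (∀ k → SedCand S (C s) u k → k ≡ j ⊎ k ≺ j) → M ≡ j
      seduces-M r₂≤s s≤r₄ candidate largest with largest M (M-candidate r₂≤s s≤r₄)
      ... | inj₁ M≡j = M≡j
      ... | inj₂ M≺j with _ ∈? A
      ...   | yes j∈A = ⊥-elim (M-largest _ j∈A M≺j)
      ...   | no j∉A = ⊥-elim (outsider-not-candidate u∈A j∉A (≤-trans r₁≤r₂ r₂≤s) s≤r₄ candidate)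
      unpointed : ∀ {s} → r₂ ≤ s → s ≤ r₃ → p (C s) u ≡ nothing → ∀ k → Adj S u k → p (C s) k ≢ just u
      unpointed r₂≤s s≤r₃ pu≡nothing k _ with k ∈? A
      ... | yes k∈A = no-pointer-to-null u∈A k∈A r₂≤s s≤r₃ pu≡nothing
      ... | no k∉A = outsider-ignores-A u∈A k∉A (≤-trans t≤r₂ r₂≤s)
      u→M : ℕ → Set
      u→M s = p (C s) u ≡ just M
      u-null : ℕ → Set
      u-null s = p (C s) u ≡ nothing
      keeps-M : ∀ s → r₂ ≤ s → s < r₃ → u→M s → u→M (suc s)
      keeps-M s r₂≤s s<r₃ = pointer-stays u∈A r₂≤s (≤-trans s<r₃ r₃≤r₄)
      null-step : ∀ s → r₂ ≤ s → s < r₃ → u-null s → u→M (suc s) ⊎ u-null (suc s)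
      null-step s r₂≤s s<r₃ pu≡nothing with null-pointer-step pu≡nothing
      ... | stays-null pu≡nothing′ = inj₂ pu≡nothing′
      ... | marries k _ pk≡u pu≡k = ⊥-elim (no-marriage u∈A r₂≤s (≤-trans s<r₃ r₃≤r₄) pk≡u pu≡k)
      ... | seduces _ j candidate largest pu≡j
        with seduces-M r₂≤s (<⇒≤ (≤-trans s<r₃ r₃≤r₄)) candidate largest
      ...   | refl = inj₁ pu≡j
      M-or-null : ∀ s → r₂ ≤ s → s ≤ r₃ → u→M s ⊎ u-null s
      M-or-null = interval-induction (λ s → u→M s ⊎ u-null s)
        (λ s r₂≤s s<r₃ → [ inj₁ ∘ keeps-M s r₂≤s s<r₃ , null-step s r₂≤s s<r₃ ]′)
        (inj₂ (all-null-at-r₂ u∈A))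
      seduction-enabled : ∀ s → r₂ ≤ s → s ≤ r₃ → u-null s → Eligible S (C s) u
      seduction-enabled s r₂≤s s≤r₃ pu≡nothing = seduction
        (synced u∈A (≤-trans r₁≤r₂ r₂≤s) (≤-trans s≤r₃ r₃≤r₄) , pu≡nothing ,
         unpointed r₂≤s s≤r₃ pu≡nothing , M , M-candidate r₂≤s (≤-trans s≤r₃ r₃≤r₄))
      seduction-move : ∀ s → r₂ ≤ s → s < r₃ → u-null s → moves e s u ≡ true → u→M (suc s)
      seduction-move s r₂≤s s<r₃ pu≡nothing moved with move-of moved
      ... | update (enabled , _) = ⊥-elim (MSync⇒¬UpdateEn {C s} {u}
              (synced u∈A (≤-trans r₁≤r₂ r₂≤s) (<⇒≤ (≤-trans s<r₃ r₃≤r₄))) enabled)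
      ... | marriage (_ , _ , k , _ , pk≡u , pu≡k) =
              ⊥-elim (no-marriage u∈A r₂≤s (≤-trans s<r₃ r₃≤r₄) pk≡u pu≡k)
      ... | seduction (_ , _ , j , candidate , largest , pu≡j)
        with seduces-M r₂≤s (<⇒≤ (≤-trans s<r₃ r₃≤r₄)) candidate largest
      ...   | refl = pu≡j
      seduction-move s r₂≤s s<r₃ pu≡nothing moved | abandonment ((_ , _ , pu≡j , _) , _) =
        ⊥-elim (just≢nothing (trans (sym pu≡j) pu≡nothing))
      u→M-at-r₃ : u→M r₃
      u→M-at-r₃ = round-establishes u u→M u-null (proj₁ (proj₂ round₃)) r₂≤r₃
        keeps-M M-or-null seduction-enabled seduction-move

    contradiction-if-two-members : 1 < ∣ A ∣ → ⊥
    contradiction-if-two-members 1<∣A∣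
      with maximal O ident (allFin n) ∈-allFin (_∈? A) (0<∣p∣⇒Nonempty A (≤-trans (n≤1+n 1) 1<∣A∣))
    ... | M , M∈A , M-largest with 1<∣p∣⇒∃≢ A 1<∣A∣ M
    ...   | y , y∈A , y≢M with PathIn-first (proj₁ (proj₂ maxA) M y M∈A y∈A) (y≢M ∘ sym)
    ...     | u , adj , u∈A = maximum-not-seduced M∈A M-largest u∈A adj

  member-married-at-r₄ : 1 < ∣ A ∣ → ∃ λ i → i ∈ A × PRmarried S (C r₄) i
  member-married-at-r₄ 1<∣A∣ with any? (λ i → (i ∈? A) ×-dec PRmarried? (C r₄) i)
  ... | yes found = found
  ... | no none = ⊥-elim (NoMemberMarried.contradiction-if-two-members
                           (λ i∈A married → none (_ , i∈A , married)) 1<∣A∣)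

  two-members-inactive-at-r₄ : 1 < ∣ A ∣ → ∃ λ i → ∃ λ j → i ∈ A × j ∈ A × i ≢ j ×
    ¬ Active S (C r₄) i × ¬ Active S (C r₄) j
  two-members-inactive-at-r₄ 1<∣A∣ with member-married-at-r₄ 1<∣A∣
  ... | i , i∈A , j , adj , pi≡j , pj≡i with j ∈? A
  ...   | no j∉A = ⊥-elim (outsider-ignores-A i∈A j∉A (≤-trans t≤r₂ r₂≤r₄) pj≡i)
  ...   | yes j∈A = i , j , i∈A , j∈A , Adj⇒≢ adj ,
                    (λ active → proj₁ active (j , adj , pi≡j , pj≡i)) ,
                    (λ active → proj₁ active (i , Adj-sym adj , pj≡i , pi≡j))

lemma7 : (S : System) (e : Execution S) (t : ℕ) (A : Subset (System.n S)) →
    MaxConnActive S (conf e t) A → 2 < ∣ A ∣ →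
    (r₁ r₂ r₃ r₄ : ℕ) →
    RoundEnd S e t r₁ → RoundEnd S e r₁ r₂ → RoundEnd S e r₂ r₃ → RoundEnd S e r₃ r₄ →
    Σ (Subset (System.n S)) λ Still →
      (∀ i → (i ∈ Still) ⇔ (i ∈ A × Active S (conf e r₄) i)) × ∣ Still ∣ + 2 ≤ ∣ A ∣
lemma7 S e t A maxA 2<∣A∣ r₁ r₂ r₃ r₄ round₁ round₂ round₃ round₄
  with FourRounds.two-members-inactive-at-r₄ S e t A maxA r₁ r₂ r₃ r₄ round₁ round₂ round₃ round₄
         (≤-trans (n≤1+n 2) 2<∣A∣)
... | i , j , i∈A , j∈A , i≢j , i-inactive , j-inactive =
  subsetOf still? , ∈-subsetOf⇔ still? ,
  ∣p∣+2≤∣q∣ (proj₁ ∘ still) i∈A j∈A i≢j (i-inactive ∘ proj₂ ∘ still) (j-inactive ∘ proj₂ ∘ still)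
  where
  open SystemFacts S using (Active?)
  still? : Decidable λ k → k ∈ A × Active S (conf e r₄) k
  still? k = (k ∈? A) ×-dec Active? (conf e r₄) k
  still : ∀ {k} → k ∈ subsetOf still? → k ∈ A × Active S (conf e r₄) k
  still {k} = Equivalence.to (∈-subsetOf⇔ still? k)
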